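{- For every hexagon $X$ of the dappled triangular grid $\mathbf{T}$, the hued graph $X^{ - }$ is a retract of the hued graph $\mathbf{T}^{ - }$.
   Context: A hued graph is a graph with a proper 3-coloring $\psi:V\to\mathbb{Z}_3$ (hue); a dappled graph is a hued graph with additionally a proper 4-coloring $\varphi:V\to\mathbb{Z}_2^2$ (color). For a dappled graph $G$, $G^{ - }$ is the hued graph obtained by forgetting the colors. Homomorphisms of hued graphs map edges to edges and preserve hue. The dappled triangular grid $\mathbf{T}$ has vertex set $\mathbb{Z}^2$, with $(i_1,j_1)\sim(i_2,j_2)$ iff $(i_2-i_1,j_2-j_1)\in\{\pm(1,0),\pm(0,1),\pm(1,1)\}$, hue $(i+j)\bmod 3$ and color $(i\bmod 2,j\bmod 2)$. A hexagon is a dappled subgraph of $\mathbf{T}$ induced by a vertex and its (six) neighbors. A retract of a hued graph $G$ is an induced subgraph $H$ of $G$ for which there exists a retraction, i.e. a homomorphism of hued graphs $f$ from $G$ to $H$ with $f(v)=v$ for every $v\in V(H)$. -}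

module Defs where

open import Data.Nat using (ℕ)
open import Data.Integer using (ℤ; _+_; _-_; +_; -_)
open import Data.Integer.DivMod using (_%ℕ_)
open import Data.Product using (_×_; _,_; Σ)
open import Data.Sum using (_⊎_)
open import Relation.Binary.PropositionalEquality using (_≡_)

V : Set
V = ℤ × ℤ

data Step : V → Set where
  e₁  : Step (+ 1 , + 0)
  e₁' : Step (- + 1 , + 0)
  e₂  : Step (+ 0 , + 1)
  e₂' : Step (+ 0 , - + 1)
  e₃  : Step (+ 1 , + 1)
  e₃' : Step (- + 1 , - + 1)

diff : V → V → V
diff (i₁ , j₁) (i₂ , j₂) = (i₂ - i₁ , j₂ - j₁)

Adj : V → V → Set
Adj u v = Step (diff u v)

hue : V → ℕ
hue (i , j) = (i + j) %ℕ 3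

InHex : V → V → Set
InHex c v = (v ≡ c) ⊎ Adj c v

-- X⁻ (the hexagon at c, colors forgotten) is a retract of T⁻:
-- there is a hued-graph homomorphism f : T⁻ → X⁻ (X⁻ being the induced
-- subgraph, so edges of X⁻ are exactly the T-edges between its vertices)
-- fixing every vertex of X.
IsRetraction : V → (V → V) → Set
IsRetraction c f =
  ((v : V) → InHex c (f v)) ×
  ((u v : V) → Adj u v → Adj (f u) (f v)) ×
  ((v : V) → hue (f v) ≡ hue v) ×
  ((v : V) → InHex c v → f v ≡ v)

HexRetractOfT : V → Set
HexRetractOfT c = Σ (V → V) (IsRetraction c)

-- Sending every vertex to the vertex of the same hue in the triangle
-- {(0,0), (1,0), (1,1)} of the hexagon X at the origin is a homomorphism, but it does
-- not fix the other three rim vertices of X.  Changing it on six residue classes of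
-- ℤ² mod 6 repairs this while keeping it a homomorphism, which is a finite check on
-- the torus (ℤ/6)².  Translations conjugate retractions to retractions, since the
-- hue of a sum is the sum of the hues mod 3.
module Submission where

open import Defs
open import Data.Fin using (Fin; toℕ)
open import Data.Fin.Patterns using (0F; 1F; 4F; 5F)
open import Data.Fin.Properties using (all?; toℕ-fromℕ<; toℕ-injective) renaming (_≟_ to _≟₆_)
open import Data.Nat as ℕ using (ℕ; zero; suc; _%_; _∸_)
import Data.Nat.Properties as ℕ
open import Data.Nat.DivMod using (_mod_; %-distribˡ-+; m∣n⇒o%n%m≡o%m)
open import Data.Nat.Divisibility using (divides)
open import Data.Integer as ℤ using (ℤ; +_; -[1+_]; _+_; _-_; -_; _%ℕ_)
import Data.Integer.Properties as ℤ
open import Data.Integer.Solver using (module +-*-Solver)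
open import Data.Product using (_,_; proj₁; proj₂)
open import Data.Product.Properties using (≡-dec)
open import Data.Sum using (inj₁; inj₂)
open import Relation.Binary.Definitions using (DecidableEquality)
open import Relation.Nullary using (Dec; yes; no)
open import Relation.Nullary.Decidable using (from-yes; _⊎-dec_)
open import Relation.Binary.PropositionalEquality

open +-*-Solver using (solve; _:=_; _:+_; _:-_; :-_)

ℤ₆ : Set
ℤ₆ = Fin 6

infixl 6 _+₆_

_+₆_ : ℤ₆ → ℤ₆ → ℤ₆
a +₆ b = (toℕ a ℕ.+ toℕ b) mod 6

-₆_ : ℤ₆ → ℤ₆
-₆ a = (6 ∸ toℕ a) mod 6

mod₃ : ℤ₆ → ℕ
mod₃ a = toℕ a % 3

-- Mirrors the negative clause of _%ℕ_, so that -[1+n]%ℕ3 holds by computation.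
neg₃ : ℕ → ℕ
neg₃ zero          = 0
neg₃ r@(suc _)     = 3 ∸ r

+₆-identityʳ : ∀ a → a +₆ 0F ≡ a
+₆-identityʳ = from-yes (all? λ a → a +₆ 0F ≟₆ a)

+₆-assoc : ∀ a b c → a +₆ b +₆ c ≡ a +₆ (b +₆ c)
+₆-assoc = from-yes (all? λ a → all? λ b → all? λ c → a +₆ b +₆ c ≟₆ a +₆ (b +₆ c))

-₆-+₆-1 : ∀ a → -₆ (a +₆ 1F) +₆ 1F ≡ -₆ a
-₆-+₆-1 = from-yes (all? λ a → -₆ (a +₆ 1F) +₆ 1F ≟₆ -₆ a)

mod₃-neg : ∀ a → mod₃ (-₆ a) ≡ neg₃ (mod₃ a)
mod₃-neg = from-yes (all? λ a → mod₃ (-₆ a) ℕ.≟ neg₃ (mod₃ a))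

%6%3≡%3 : ∀ n → n % 6 % 3 ≡ n % 3
%6%3≡%3 n = m∣n⇒o%n%m≡o%m 3 6 n (divides 2 refl)

toℕ-mod : ∀ n → toℕ (n mod 6) ≡ n % 6
toℕ-mod n = toℕ-fromℕ< _

mod₃-+₆ : ∀ a b → mod₃ (a +₆ b) ≡ (mod₃ a ℕ.+ mod₃ b) % 3
mod₃-+₆ a b = begin
  toℕ (a +₆ b) % 3                  ≡⟨ cong (_% 3) (toℕ-mod (toℕ a ℕ.+ toℕ b)) ⟩
  (toℕ a ℕ.+ toℕ b) % 6 % 3         ≡⟨ %6%3≡%3 (toℕ a ℕ.+ toℕ b) ⟩
  (toℕ a ℕ.+ toℕ b) % 3             ≡⟨ %-distribˡ-+ (toℕ a) (toℕ b) 3 ⟩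
  (mod₃ a ℕ.+ mod₃ b) % 3           ∎
  where open ≡-Reasoning

suc-mod : ∀ n → suc n mod 6 ≡ n mod 6 +₆ 1F
suc-mod n = toℕ-injective (begin
  toℕ (suc n mod 6)                 ≡⟨ toℕ-mod (suc n) ⟩
  suc n % 6                         ≡⟨ cong (_% 6) (ℕ.+-comm 1 n) ⟩
  (n ℕ.+ 1) % 6                     ≡⟨ %-distribˡ-+ n 1 6 ⟩
  (n % 6 ℕ.+ 1) % 6                 ≡⟨ cong (λ k → (k ℕ.+ 1) % 6) (toℕ-mod n) ⟨
  (toℕ (n mod 6) ℕ.+ 1) % 6         ≡⟨ toℕ-mod (toℕ (n mod 6) ℕ.+ 1) ⟨
  toℕ (n mod 6 +₆ 1F)               ∎)
  where open ≡-Reasoning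

[_]₆ : ℤ → ℤ₆
[ + n      ]₆ = n mod 6
[ -[1+ n ] ]₆ = -₆ (suc n mod 6)

[z+1]₆ : ∀ z → [ z + + 1 ]₆ ≡ [ z ]₆ +₆ 1F
[z+1]₆ (+ n)            = trans (cong (_mod 6) (ℕ.+-comm n 1)) (suc-mod n)
[z+1]₆ -[1+ zero ]      = refl
[z+1]₆ -[1+ suc n ]     = begin
  -₆ (suc n mod 6)                  ≡⟨ -₆-+₆-1 (suc n mod 6) ⟨
  -₆ (suc n mod 6 +₆ 1F) +₆ 1F      ≡⟨ cong (λ a → -₆ a +₆ 1F) (suc-mod (suc n)) ⟨
  -₆ (suc (suc n) mod 6) +₆ 1F      ∎
  where open ≡-Reasoning

[z-1]₆ : ∀ z → [ z - + 1 ]₆ ≡ [ z ]₆ +₆ 5F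
[z-1]₆ z = begin
  [ z - + 1 ]₆                      ≡⟨ +₆-identityʳ [ z - + 1 ]₆ ⟨
  [ z - + 1 ]₆ +₆ (1F +₆ 5F)        ≡⟨ +₆-assoc [ z - + 1 ]₆ 1F 5F ⟨
  [ z - + 1 ]₆ +₆ 1F +₆ 5F          ≡⟨ cong (_+₆ 5F) ([z+1]₆ (z - + 1)) ⟨
  [ z - + 1 + + 1 ]₆ +₆ 5F          ≡⟨ cong (λ w → [ w ]₆ +₆ 5F) (ℤ.+-assoc z (- + 1) (+ 1)) ⟩
  [ z + + 0 ]₆ +₆ 5F                ≡⟨ cong (λ w → [ w ]₆ +₆ 5F) (ℤ.+-identityʳ z) ⟩
  [ z ]₆ +₆ 5F                      ∎
  where open ≡-Reasoning

ℤ-induction : (P : ℤ → Set) → P (+ 0) →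
              (∀ z → P z → P (z + + 1)) → (∀ z → P z → P (z - + 1)) → ∀ z → P z
ℤ-induction P P0 up down = go
  where
  go : ∀ z → P z
  go (+ zero)         = P0
  go (+ suc n)        = subst P (cong +_ (ℕ.+-comm n 1)) (up (+ n) (go (+ n)))
  go -[1+ zero ]      = down (+ 0) P0
  go -[1+ suc n ]     = subst P (cong (λ k → -[1+ suc k ]) (ℕ.+-identityʳ n)) (down -[1+ n ] (go -[1+ n ]))

[x+y]₆ : ∀ x y → [ x + y ]₆ ≡ [ x ]₆ +₆ [ y ]₆
[x+y]₆ x = ℤ-induction (λ y → [ x + y ]₆ ≡ [ x ]₆ +₆ [ y ]₆)
  (trans (cong [_]₆ (ℤ.+-identityʳ x)) (sym (+₆-identityʳ [ x ]₆)))
  (step (+ 1) 1F [z+1]₆) (step (- + 1) 5F [z-1]₆)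
  where
  open ≡-Reasoning
  step : ∀ u k → (∀ z → [ z + u ]₆ ≡ [ z ]₆ +₆ k) →
         ∀ y → [ x + y ]₆ ≡ [ x ]₆ +₆ [ y ]₆ → [ x + (y + u) ]₆ ≡ [ x ]₆ +₆ [ y + u ]₆
  step u k [+u] y ih = begin
    [ x + (y + u) ]₆                ≡⟨ cong [_]₆ (ℤ.+-assoc x y u) ⟨
    [ x + y + u ]₆                  ≡⟨ [+u] (x + y) ⟩
    [ x + y ]₆ +₆ k                 ≡⟨ cong (_+₆ k) ih ⟩
    [ x ]₆ +₆ [ y ]₆ +₆ k           ≡⟨ +₆-assoc [ x ]₆ [ y ]₆ k ⟩
    [ x ]₆ +₆ ([ y ]₆ +₆ k)         ≡⟨ cong ([ x ]₆ +₆_) ([+u] y) ⟨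
    [ x ]₆ +₆ [ y + u ]₆            ∎

-[1+n]%ℕ3 : ∀ n → -[1+ n ] %ℕ 3 ≡ neg₃ (suc n % 3)
-[1+n]%ℕ3 n with suc n % 3
... | zero  = refl
... | suc _ = refl

%ℕ3≡mod₃ : ∀ z → z %ℕ 3 ≡ mod₃ [ z ]₆
%ℕ3≡mod₃ (+ n)      = sym (trans (cong (_% 3) (toℕ-mod n)) (%6%3≡%3 n))
%ℕ3≡mod₃ -[1+ n ]   = begin
  -[1+ n ] %ℕ 3                     ≡⟨ -[1+n]%ℕ3 n ⟩
  neg₃ (suc n % 3)                  ≡⟨ cong neg₃ (%ℕ3≡mod₃ (+ suc n)) ⟩
  neg₃ (mod₃ (suc n mod 6))         ≡⟨ mod₃-neg (suc n mod 6) ⟨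
  mod₃ (-₆ (suc n mod 6))           ∎
  where open ≡-Reasoning

%ℕ3-distrib-+ : ∀ x y → (x + y) %ℕ 3 ≡ (x %ℕ 3 ℕ.+ y %ℕ 3) % 3
%ℕ3-distrib-+ x y = begin
  (x + y) %ℕ 3                      ≡⟨ %ℕ3≡mod₃ (x + y) ⟩
  mod₃ [ x + y ]₆                   ≡⟨ cong mod₃ ([x+y]₆ x y) ⟩
  mod₃ ([ x ]₆ +₆ [ y ]₆)           ≡⟨ mod₃-+₆ [ x ]₆ [ y ]₆ ⟩
  (mod₃ [ x ]₆ ℕ.+ mod₃ [ y ]₆) % 3 ≡⟨ cong₂ (λ r s → (r ℕ.+ s) % 3) (%ℕ3≡mod₃ x) (%ℕ3≡mod₃ y) ⟨
  (x %ℕ 3 ℕ.+ y %ℕ 3) % 3           ∎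
  where open ≡-Reasoning

infixl 6 _⊞_

_⊞_ : V → V → V
(x , y) ⊞ (x′ , y′) = (x + x′ , y + y′)

⊟_ : V → V
⊟ (x , y) = (- x , - y)

origin : V
origin = (+ 0 , + 0)

diff-⊞ʳ : ∀ u v d → diff (u ⊞ d) (v ⊞ d) ≡ diff u v
diff-⊞ʳ (x , y) (x′ , y′) (e , f) = cong₂ _,_ (lemma x x′ e) (lemma y y′ f)
  where
  lemma : ∀ a b c → (b + c) - (a + c) ≡ b - a
  lemma = solve 3 (λ a b c → (b :+ c) :- (a :+ c) := b :- a) refl

⊞-diff : ∀ u v → u ⊞ diff u v ≡ v
⊞-diff (x , y) (x′ , y′) = cong₂ _,_ (lemma x x′) (lemma y y′)
  where
  lemma : ∀ a b → a + (b - a) ≡ b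
  lemma = solve 2 (λ a b → a :+ (b :- a) := b) refl

⊞-⊟-cancel : ∀ v d → v ⊞ d ⊞ ⊟ d ≡ v
⊞-⊟-cancel (x , y) (e , f) = cong₂ _,_ (lemma x e) (lemma y f)
  where
  lemma : ∀ a b → a + b + - b ≡ a
  lemma = solve 2 (λ a b → a :+ b :+ :- b := a) refl

⊟-⊞-cancel : ∀ v d → v ⊞ ⊟ d ⊞ d ≡ v
⊟-⊞-cancel (x , y) (e , f) = cong₂ _,_ (lemma x e) (lemma y f)
  where
  lemma : ∀ a b → a + - b + b ≡ a
  lemma = solve 2 (λ a b → a :+ :- b :+ b := a) refl

origin-⊞ : ∀ d → origin ⊞ d ≡ d
origin-⊞ (e , f) = cong₂ _,_ (ℤ.+-identityˡ e) (ℤ.+-identityˡ f)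

Adj-⊞ : ∀ u v d → Adj u v → Adj (u ⊞ d) (v ⊞ d)
Adj-⊞ u v d = subst Step (sym (diff-⊞ʳ u v d))

InHex-⊞ : ∀ c v d → InHex c v → InHex (c ⊞ d) (v ⊞ d)
InHex-⊞ c v d (inj₁ v≡c) = inj₁ (cong (_⊞ d) v≡c)
InHex-⊞ c v d (inj₂ adj) = inj₂ (Adj-⊞ c v d adj)

hue-⊞ : ∀ p d → hue (p ⊞ d) ≡ (hue p ℕ.+ hue d) % 3
hue-⊞ (x , y) (e , f) = trans (cong (_%ℕ 3) (regroup x y e f)) (%ℕ3-distrib-+ (x + y) (e + f))
  where
  regroup : ∀ a b c d → a + c + (b + d) ≡ a + b + (c + d)
  regroup = solve 4 (λ a b c d → a :+ c :+ (b :+ d) := a :+ b :+ (c :+ d)) refl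

translate-retraction : ∀ {c g} d → IsRetraction c g → IsRetraction (c ⊞ d) (λ v → g (v ⊞ ⊟ d) ⊞ d)
translate-retraction {c} {g} d (onto , hom , hue-pres , fixes) =
  (λ v → InHex-⊞ c (g (v ⊞ ⊟ d)) d (onto (v ⊞ ⊟ d))) ,
  (λ u v adj → Adj-⊞ (g (u ⊞ ⊟ d)) (g (v ⊞ ⊟ d)) d (hom (u ⊞ ⊟ d) (v ⊞ ⊟ d) (Adj-⊞ u v (⊟ d) adj))) ,
  hue-pres′ ,
  fixes′
  where
  open ≡-Reasoning
  hue-pres′ : ∀ v → hue (g (v ⊞ ⊟ d) ⊞ d) ≡ hue v
  hue-pres′ v = begin
    hue (g (v ⊞ ⊟ d) ⊞ d)                   ≡⟨ hue-⊞ (g (v ⊞ ⊟ d)) d ⟩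
    (hue (g (v ⊞ ⊟ d)) ℕ.+ hue d) % 3       ≡⟨ cong (λ h → (h ℕ.+ hue d) % 3) (hue-pres (v ⊞ ⊟ d)) ⟩
    (hue (v ⊞ ⊟ d) ℕ.+ hue d) % 3           ≡⟨ hue-⊞ (v ⊞ ⊟ d) d ⟨
    hue (v ⊞ ⊟ d ⊞ d)                       ≡⟨ cong hue (⊟-⊞-cancel v d) ⟩
    hue v                                   ∎
  fixes′ : ∀ v → InHex (c ⊞ d) v → g (v ⊞ ⊟ d) ⊞ d ≡ v
  fixes′ v v∈X = begin
    g (v ⊞ ⊟ d) ⊞ d                         ≡⟨ cong (_⊞ d) (fixes (v ⊞ ⊟ d) v-d∈X) ⟩
    v ⊞ ⊟ d ⊞ d                             ≡⟨ ⊟-⊞-cancel v d ⟩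
    v                                       ∎
    where
    v-d∈X : InHex c (v ⊞ ⊟ d)
    v-d∈X = subst (λ c′ → InHex c′ (v ⊞ ⊟ d)) (⊞-⊟-cancel c d) (InHex-⊞ (c ⊞ d) v (⊟ d) v∈X)

translate-HexRetract : ∀ {c} d → HexRetractOfT c → HexRetractOfT (c ⊞ d)
translate-HexRetract d (g , g-retraction) = _ , translate-retraction d g-retraction

_≟V_ : DecidableEquality V
_≟V_ = ≡-dec ℤ._≟_ ℤ._≟_

step? : (s : V) → Dec (Step s)
step? s with s ≟V (+ 1 , + 0) | s ≟V (- + 1 , + 0) | s ≟V (+ 0 , + 1)
           | s ≟V (+ 0 , - + 1) | s ≟V (+ 1 , + 1) | s ≟V (- + 1 , - + 1)
... | yes refl | _        | _        | _        | _        | _        = yes e₁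
... | _        | yes refl | _        | _        | _        | _        = yes e₁'
... | _        | _        | yes refl | _        | _        | _        = yes e₂
... | _        | _        | _        | yes refl | _        | _        = yes e₂'
... | _        | _        | _        | _        | yes refl | _        = yes e₃
... | _        | _        | _        | _        | _        | yes refl = yes e₃'
... | no ≢e₁   | no ≢e₁'  | no ≢e₂   | no ≢e₂'  | no ≢e₃   | no ≢e₃'  = no λ where
  e₁  → ≢e₁ refl
  e₁' → ≢e₁' refl
  e₂  → ≢e₂ refl
  e₂' → ≢e₂' refl
  e₃  → ≢e₃ refl
  e₃' → ≢e₃' refl

InHex? : ∀ c v → Dec (InHex c v)
InHex? c v = v ≟V c ⊎-dec step? (diff c v)

triangle : ℕ → V
triangle 0 = origin
triangle 1 = (+ 1 , + 0)
triangle _ = (+ 1 , + 1)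

-- The classes of (0,±1), (-1,0), (-1,-1) are the rim vertices outside the triangle;
-- those of (-2,0), (-2,-2) are their neighbours whose image must be moved with them.
fold : ℤ₆ → ℤ₆ → V
fold 0F 1F = (+ 0 , + 1)
fold 0F 5F = (+ 0 , - + 1)
fold 4F 0F = (+ 0 , + 1)
fold 4F 4F = (+ 0 , - + 1)
fold 5F 0F = (- + 1 , + 0)
fold 5F 5F = (- + 1 , - + 1)
fold a  b  = triangle (mod₃ (a +₆ b))

fold-onto : ∀ a b → InHex origin (fold a b)
fold-onto = from-yes (all? λ a → all? λ b → InHex? origin (fold a b))

fold-hue : ∀ a b → hue (fold a b) ≡ (mod₃ a ℕ.+ mod₃ b) % 3
fold-hue = from-yes (all? λ a → all? λ b → hue (fold a b) ℕ.≟ (mod₃ a ℕ.+ mod₃ b) % 3)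

FoldAdjacentAlong : V → Set
FoldAdjacentAlong s = ∀ a b → Adj (fold a b) (fold (a +₆ [ proj₁ s ]₆) (b +₆ [ proj₂ s ]₆))

foldAdjacentAlong? : ∀ s → Dec (FoldAdjacentAlong s)
foldAdjacentAlong? s = all? λ a → all? λ b → step? _

fold-adjacent : ∀ {s} → Step s → FoldAdjacentAlong s
fold-adjacent {s} e₁  = from-yes (foldAdjacentAlong? s)
fold-adjacent {s} e₁' = from-yes (foldAdjacentAlong? s)
fold-adjacent {s} e₂  = from-yes (foldAdjacentAlong? s)
fold-adjacent {s} e₂' = from-yes (foldAdjacentAlong? s)
fold-adjacent {s} e₃  = from-yes (foldAdjacentAlong? s)
fold-adjacent {s} e₃' = from-yes (foldAdjacentAlong? s)

retract₀ : V → V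
retract₀ (x , y) = fold [ x ]₆ [ y ]₆

retract₀-adjacent : ∀ u {s} → Step s → Adj (retract₀ u) (retract₀ (u ⊞ s))
retract₀-adjacent (x , y) {s₁ , s₂} st
  rewrite [x+y]₆ x s₁ | [x+y]₆ y s₂ = fold-adjacent st [ x ]₆ [ y ]₆

retract₀-hue : ∀ v → hue (retract₀ v) ≡ hue v
retract₀-hue (x , y) = begin
  hue (fold [ x ]₆ [ y ]₆)                ≡⟨ fold-hue [ x ]₆ [ y ]₆ ⟩
  (mod₃ [ x ]₆ ℕ.+ mod₃ [ y ]₆) % 3       ≡⟨ cong₂ (λ r s → (r ℕ.+ s) % 3) (%ℕ3≡mod₃ x) (%ℕ3≡mod₃ y) ⟨
  (x %ℕ 3 ℕ.+ y %ℕ 3) % 3                 ≡⟨ %ℕ3-distrib-+ x y ⟨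
  hue (x , y)                             ∎
  where open ≡-Reasoning

retract₀-fixes-rim : ∀ {v} → Step v → retract₀ v ≡ v
retract₀-fixes-rim e₁  = refl
retract₀-fixes-rim e₁' = refl
retract₀-fixes-rim e₂  = refl
retract₀-fixes-rim e₂' = refl
retract₀-fixes-rim e₃  = refl
retract₀-fixes-rim e₃' = refl

diff-origin : ∀ v → diff origin v ≡ v
diff-origin (x , y) = cong₂ _,_ (ℤ.+-identityʳ x) (ℤ.+-identityʳ y)

retract₀-retraction : IsRetraction origin retract₀
retract₀-retraction =
  (λ { (x , y) → fold-onto [ x ]₆ [ y ]₆ }) ,
  (λ u v adj → subst (λ w → Adj (retract₀ u) (retract₀ w)) (⊞-diff u v) (retract₀-adjacent u adj)) ,
  retract₀-hue ,
  λ where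
    v (inj₁ refl) → refl
    v (inj₂ adj)  → retract₀-fixes-rim (subst Step (diff-origin v) adj)

lemma10 : (c : V) → HexRetractOfT c
lemma10 c = subst HexRetractOfT (origin-⊞ c) (translate-HexRetract c (retract₀ , retract₀-retraction))
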